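{- Let $\mathcal{A}=(a_n)_{n\in\mathbb{N}_+}$ be a sequence of positive integers and let $m>1$ be an integer. For each positive integer $k$, \[ \lim_{N\to\infty}\frac{\#\{n\leqslant N:\ p_\mathcal{A}(n,k)\not\equiv 0\pmod{m}\}}{N}\geqslant\frac{1}{\sum_{i=1}^k a_i}. \]
   Context: $\mathbb{N}=\{0,1,2,\ldots\}$, and $n$ ranges over $\mathbb{N}$. For $k\in\mathbb{N}_+$ and $n\in\mathbb{N}$, $p_\mathcal{A}(n,k)$ is the number of tuples $(x_1,\ldots,x_k)\in\mathbb{N}^k$ with $a_1x_1+\cdots+a_kx_k=n$, i.e. $\sum_{n\ge0}p_\mathcal{A}(n,k)x^n=\prod_{i=1}^k(1-x^{a_i})^{ -1}$. -}

module Defs where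

open import Data.Nat using (ℕ; zero; suc; _+_; _*_; _≟_)
open import Data.Nat.Divisibility using (_∣?_)
open import Data.List using (List; []; _∷_; [_]; map; concatMap; upTo; length; filter)
open import Data.Vec using (Vec; []; _∷_)
open import Relation.Nullary.Decidable using (¬?)
open import Data.Integer using (+_)
open import Data.Rational using (ℚ; _/_)

-- a i  stands for the paper's  a_{i+1}  (so the sequence is indexed from 0 here)
-- weighted sum a_1 x_1 + ... + a_k x_k of a tuple (x_1,...,x_k)
wsum : {k : ℕ} → (ℕ → ℕ) → Vec ℕ k → ℕ
wsum a []       = 0
wsum a (x ∷ xs) = a 0 * x + wsum (λ i → a (suc i)) xs

allVecs : (b k : ℕ) → List (Vec ℕ k)
allVecs b zero    = [ [] ]
allVecs b (suc k) = concatMap (λ x → map (x ∷_) (allVecs b k)) (upTo (suc b))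

-- p_A(n,k): number of (x_1..x_k) ∈ ℕ^k with Σ a_i x_i = n.
-- (When all a_i ≥ 1 every such tuple has all x_i ≤ n, so enumerating {0..n}^k is exhaustive.)
pA : (ℕ → ℕ) → ℕ → ℕ → ℕ
pA a n k = length (filter (λ v → wsum a v ≟ n) (allVecs n k))

sumA : (ℕ → ℕ) → ℕ → ℕ
sumA a zero    = 0
sumA a (suc k) = sumA a k + a k

count : (ℕ → ℕ) → ℕ → ℕ → ℕ → ℕ
count a m k N = length (filter (λ n → ¬? (m ∣? pA a n k)) (upTo (suc N)))

ratio : (ℕ → ℕ) → ℕ → ℕ → ℕ → ℚ
ratio a m k M = (+ count a m k (suc M)) / suc M

-- Write p(n) = p_A(n,k) and p′(n) for the count with a₂, …, a_k. Splitting off x₁ gives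
-- p(n + a₁) = p′(n + a₁) + p(n). Summed over m·T steps this shows, by induction on k, that p is
-- periodic modulo m: if p′ is T-periodic mod m, the m·T new terms form m full periods and vanish
-- mod m. So the indicator of m ∤ p(n) is periodic, its partial sums are linear up to a bounded
-- error, and count(N)/N is Cauchy. The same identity shows that every window of length
-- a₁ + ⋯ + a_k contains some n with m ∤ p(n): if m ∤ p′(n′) but m ∣ p(n′), then m ∤ p(n′ − a₁).
-- One counted n per window gives the density bound 1/(a₁ + ⋯ + a_k).

module Submission where

module FiniteSums where

  open import Data.Nat
  open import Data.Nat.Properties
  open import Data.Nat.DivMod using (%-distribˡ-+; m%n%n≡m%n; m*n%n≡0)
  open import Data.Nat.Tactic.RingSolver using (solve-∀)
  open import Data.List using (List; []; _∷_; map; filter; length; concatMap; applyUpTo; _++_)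
  open import Data.List.Properties using (length-++; filter-++)
  open import Relation.Nullary using (Dec; yes; no; ¬_; contradiction)
  open import Relation.Unary using (Pred; Decidable)
  open import Relation.Binary.PropositionalEquality
  open import Data.Sum using (inj₁; inj₂)
  open import Function using (_∘_)

  ∑ : ℕ → (ℕ → ℕ) → ℕ
  ∑ zero    f = 0
  ∑ (suc n) f = ∑ n f + f n

  ∑-cong : ∀ n {f g : ℕ → ℕ} → (∀ i → f i ≡ g i) → ∑ n f ≡ ∑ n g
  ∑-cong zero    f≗g = refl
  ∑-cong (suc n) f≗g = cong₂ _+_ (∑-cong n f≗g) (f≗g n)

  ∑-+ : ∀ m n (f : ℕ → ℕ) → ∑ (m + n) f ≡ ∑ m f + ∑ n (λ i → f (m + i))
  ∑-+ m zero    f = trans (cong (λ l → ∑ l f) (+-identityʳ m)) (sym (+-identityʳ (∑ m f)))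
  ∑-+ m (suc n) f = begin
    ∑ (m + suc n) f                                 ≡⟨ cong (λ l → ∑ l f) (+-suc m n) ⟩
    ∑ (m + n) f + f (m + n)                         ≡⟨ cong (_+ f (m + n)) (∑-+ m n f) ⟩
    ∑ m f + ∑ n (λ i → f (m + i)) + f (m + n)       ≡⟨ +-assoc (∑ m f) _ _ ⟩
    ∑ m f + ∑ (suc n) (λ i → f (m + i))             ∎
    where open ≡-Reasoning

  ∑-suc : ∀ n (f : ℕ → ℕ) → ∑ (suc n) f ≡ f 0 + ∑ n (f ∘ suc)
  ∑-suc n f = trans (∑-+ 1 n f) (cong (_+ ∑ n (f ∘ suc)) (+-identityˡ (f 0)))

  ∑-mono-≤ : ∀ {m n} (f : ℕ → ℕ) → m ≤ n → ∑ m f ≤ ∑ n f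
  ∑-mono-≤ {m} {n} f m≤n = begin
    ∑ m f                                      ≤⟨ m≤m+n (∑ m f) _ ⟩
    ∑ m f + ∑ (n ∸ m) (λ i → f (m + i))        ≡⟨ ∑-+ m (n ∸ m) f ⟨
    ∑ (m + (n ∸ m)) f                          ≡⟨ cong (λ l → ∑ l f) (m+[n∸m]≡n m≤n) ⟩
    ∑ n f                                      ∎
    where open ≤-Reasoning

  ∑-truncate : ∀ {c n} (f : ℕ → ℕ) → c ≤ n → (∀ i → c ≤ i → f i ≡ 0) → ∑ n f ≡ ∑ c f
  ∑-truncate {c} {n} f c≤n vanish = begin
    ∑ n f                                      ≡⟨ cong (λ l → ∑ l f) (m+[n∸m]≡n c≤n) ⟨
    ∑ (c + (n ∸ c)) f                          ≡⟨ ∑-+ c (n ∸ c) f ⟩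
    ∑ c f + ∑ (n ∸ c) (λ i → f (c + i))        ≡⟨ cong (∑ c f +_) (∑-cong (n ∸ c) (λ i → vanish (c + i) (m≤m+n c i))) ⟩
    ∑ c f + ∑ (n ∸ c) (λ _ → 0)                ≡⟨ cong (∑ c f +_) (∑-zero (n ∸ c)) ⟩
    ∑ c f + 0                                  ≡⟨ +-identityʳ (∑ c f) ⟩
    ∑ c f                                      ∎
    where
    open ≡-Reasoning
    ∑-zero : ∀ l → ∑ l (λ _ → 0) ≡ 0
    ∑-zero zero    = refl
    ∑-zero (suc l) = cong (_+ 0) (∑-zero l)

  ∑-≤ : ∀ n {f : ℕ → ℕ} → (∀ i → f i ≤ 1) → ∑ n f ≤ n
  ∑-≤ zero    f≤1 = z≤n
  ∑-≤ (suc n) {f} f≤1 = subst (∑ (suc n) f ≤_) (+-comm n 1) (+-mono-≤ (∑-≤ n f≤1) (f≤1 n))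

  term≤∑ : ∀ {i n} (f : ℕ → ℕ) → i < n → f i ≤ ∑ n f
  term≤∑ {i} {suc n} f i<1+n with m≤n⇒m<n∨m≡n (s≤s⁻¹ i<1+n)
  ... | inj₁ i<n  = ≤-trans (term≤∑ f i<n) (m≤m+n (∑ n f) (f n))
  ... | inj₂ refl = m≤n+m (f i) (∑ i f)

  ∑-+-term : ∀ {t n S} (f : ℕ → ℕ) → t ≤ n → n < t + S → ∑ t f + f n ≤ ∑ (t + S) f
  ∑-+-term {t} {n} {S} f t≤n n<t+S = begin
    ∑ t f + f n                              ≡⟨ cong (λ z → ∑ t f + f z) (m+[n∸m]≡n t≤n) ⟨
    ∑ t f + f (t + (n ∸ t))                  ≤⟨ +-monoʳ-≤ (∑ t f) (term≤∑ (λ i → f (t + i)) n∸t<S) ⟩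
    ∑ t f + ∑ S (λ i → f (t + i))            ≡⟨ ∑-+ t S f ⟨
    ∑ (t + S) f                              ∎
    where
    open ≤-Reasoning
    n∸t<S : n ∸ t < S
    n∸t<S = +-cancelˡ-< t (n ∸ t) S (subst (_< t + S) (sym (m+[n∸m]≡n t≤n)) n<t+S)

  ∑-% : ∀ n (f : ℕ → ℕ) m .{{_ : NonZero m}} → ∑ n f % m ≡ ∑ n (λ i → f i % m) % m
  ∑-% zero    f m = refl
  ∑-% (suc n) f m = begin
    (∑ n f + f n) % m                                    ≡⟨ %-distribˡ-+ (∑ n f) (f n) m ⟩
    (∑ n f % m + f n % m) % m                            ≡⟨ cong (λ s → (s + f n % m) % m) (∑-% n f m) ⟩
    (∑ n (λ i → f i % m) % m + f n % m) % m              ≡⟨ cong (λ s → (∑ n (λ i → f i % m) % m + s) % m) (m%n%n≡m%n (f n) m) ⟨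
    (∑ n (λ i → f i % m) % m + f n % m % m) % m          ≡⟨ %-distribˡ-+ (∑ n (λ i → f i % m)) (f n % m) m ⟨
    (∑ n (λ i → f i % m) + f n % m) % m                  ∎
    where open ≡-Reasoning

  Periodic : ℕ → (ℕ → ℕ) → Set
  Periodic T f = ∀ n → f (T + n) ≡ f n

  periodic-* : ∀ {T} {f : ℕ → ℕ} → Periodic T f → ∀ j n → f (j * T + n) ≡ f n
  periodic-* per zero    n = refl
  periodic-* {T} {f} per (suc j) n = trans (cong f (+-assoc T (j * T) n)) (trans (per (j * T + n)) (periodic-* per j n))

  ∑-periodic : ∀ {T} {f : ℕ → ℕ} → Periodic T f → ∀ j → ∑ (j * T) f ≡ j * ∑ T f
  ∑-periodic per zero = refl
  ∑-periodic {T} {f} per (suc j) = begin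
    ∑ (T + j * T) f                          ≡⟨ ∑-+ T (j * T) f ⟩
    ∑ T f + ∑ (j * T) (λ i → f (T + i))      ≡⟨ cong (∑ T f +_) (∑-cong (j * T) per) ⟩
    ∑ T f + ∑ (j * T) f                      ≡⟨ cong (∑ T f +_) (∑-periodic per j) ⟩
    ∑ T f + j * ∑ T f                        ∎
    where open ≡-Reasoning

  telescope : ∀ {F g : ℕ → ℕ} {a} → (∀ n → F (a + n) ≡ g (a + n) + F n) →
              ∀ j n → F (a * j + n) ≡ ∑ j (λ i → g (a * suc i + n)) + F n
  telescope {F} {g} {a} rec zero    n = cong (λ z → F (z + n)) (*-zeroʳ a)
  telescope {F} {g} {a} rec (suc j) n = begin
    F (a * suc j + n)                        ≡⟨ cong F unfold ⟩
    F (a + (a * j + n))                      ≡⟨ rec (a * j + n) ⟩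
    g (a + (a * j + n)) + F (a * j + n)      ≡⟨ cong₂ _+_ (cong g (sym unfold)) (telescope {F} {g} {a} rec j n) ⟩
    g (a * suc j + n) + (∑ j h + F n)        ≡⟨ +-assoc (g (a * suc j + n)) (∑ j h) (F n) ⟨
    g (a * suc j + n) + ∑ j h + F n          ≡⟨ cong (_+ F n) (+-comm (g (a * suc j + n)) (∑ j h)) ⟩
    ∑ j h + g (a * suc j + n) + F n          ∎
    where
    open ≡-Reasoning
    h : ℕ → ℕ
    h i = g (a * suc i + n)
    unfold : a * suc j + n ≡ a + (a * j + n)
    unfold = trans (cong (_+ n) (*-suc a j)) (+-assoc a (a * j) n)

  recurrence-periodic-% : ∀ {F g : ℕ → ℕ} {a T} m .{{_ : NonZero m}} → (∀ n → F (a + n) ≡ g (a + n) + F n) →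
                          Periodic T (λ n → g n % m) → Periodic (a * (m * T)) (λ n → F n % m)
  recurrence-periodic-% {F} {g} {a} {T} m rec per n = begin
    F (a * (m * T) + n) % m                           ≡⟨ cong (_% m) (telescope {F} {g} {a} rec (m * T) n) ⟩
    (∑ (m * T) h + F n) % m                           ≡⟨ %-distribˡ-+ (∑ (m * T) h) (F n) m ⟩
    (∑ (m * T) h % m + F n % m) % m                   ≡⟨ cong (λ s → (s + F n % m) % m) full-periods ⟩
    F n % m % m                                       ≡⟨ m%n%n≡m%n (F n) m ⟩
    F n % m                                           ∎
    where
    open ≡-Reasoning
    h : ℕ → ℕ
    h i = g (a * suc i + n)
    shift : ∀ a T i n → a * suc (T + i) + n ≡ a * T + (a * suc i + n)
    shift = solve-∀
    h-periodic : Periodic T (λ i → h i % m)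
    h-periodic i = trans (cong (λ z → g z % m) (shift a T i n)) (periodic-* {f = λ z → g z % m} per a (a * suc i + n))
    full-periods : ∑ (m * T) h % m ≡ 0
    full-periods = begin
      ∑ (m * T) h % m                      ≡⟨ ∑-% (m * T) h m ⟩
      ∑ (m * T) (λ i → h i % m) % m        ≡⟨ cong (_% m) (∑-periodic h-periodic m) ⟩
      m * ∑ T (λ i → h i % m) % m          ≡⟨ cong (_% m) (*-comm m (∑ T (λ i → h i % m))) ⟩
      ∑ T (λ i → h i % m) * m % m          ≡⟨ m*n%n≡0 (∑ T (λ i → h i % m)) m ⟩
      0                                    ∎

  guard : ∀ {p} {P : Set p} → Dec P → ℕ → ℕ
  guard (yes _) n = n
  guard (no _)  n = 0

  module _ {p} {P : Set p} {n : ℕ} where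

    guard-accept : P → (d : Dec P) → guard d n ≡ n
    guard-accept _ (yes _) = refl
    guard-accept p (no ¬p) = contradiction p ¬p

    guard-reject : ¬ P → (d : Dec P) → guard d n ≡ 0
    guard-reject ¬p (yes p) = contradiction p ¬p
    guard-reject _  (no _)  = refl

    guard-≤ : (d : Dec P) → guard d n ≤ n
    guard-≤ (yes _) = ≤-refl
    guard-≤ (no _)  = z≤n

    guard-cong : ∀ {q} {Q : Set q} {n′} → (P → Q) → (Q → P) → (d : Dec P) (e : Dec Q) →
                 n ≡ n′ → guard d n ≡ guard e n′
    guard-cong P→Q Q→P (yes p) (yes q) n≡n′ = n≡n′
    guard-cong P→Q Q→P (yes p) (no ¬q) _    = contradiction (P→Q p) ¬q
    guard-cong P→Q Q→P (no ¬p) (yes q) _    = contradiction (Q→P q) ¬p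
    guard-cong P→Q Q→P (no _)  (no _)  _    = refl

  module _ {a p} {A : Set a} {P : Pred A p} (P? : Decidable P) where

    length-filter-map : ∀ {b} {B : Set b} (g : B → A) (xs : List B) →
                        length (filter P? (map g xs)) ≡ length (filter (P? ∘ g) xs)
    length-filter-map g []       = refl
    length-filter-map g (x ∷ xs) with P? (g x)
    ... | yes _ = cong suc (length-filter-map g xs)
    ... | no _  = length-filter-map g xs

    length-filter-applyUpTo : ∀ (f : ℕ → A) n → length (filter P? (applyUpTo f n)) ≡ ∑ n (λ i → guard (P? (f i)) 1)
    length-filter-applyUpTo f zero    = refl
    length-filter-applyUpTo f (suc n) = trans step (sym (∑-suc n (λ i → guard (P? (f i)) 1)))
      where
      step : length (filter P? (applyUpTo f (suc n))) ≡ guard (P? (f 0)) 1 + ∑ n (λ i → guard (P? (f (suc i))) 1)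
      step with P? (f 0)
      ... | yes _ = cong suc (length-filter-applyUpTo (f ∘ suc) n)
      ... | no _  = length-filter-applyUpTo (f ∘ suc) n

    length-filter-concatMap : ∀ (h : ℕ → List A) (f : ℕ → ℕ) n →
      length (filter P? (concatMap h (applyUpTo f n))) ≡ ∑ n (λ i → length (filter P? (h (f i))))
    length-filter-concatMap h f zero    = refl
    length-filter-concatMap h f (suc n) = begin
      length (filter P? (h (f 0) ++ rest))                     ≡⟨ cong length (filter-++ P? (h (f 0)) rest) ⟩
      length (filter P? (h (f 0)) ++ filter P? rest)           ≡⟨ length-++ (filter P? (h (f 0))) ⟩
      length (filter P? (h (f 0))) + length (filter P? rest)   ≡⟨ cong (_ +_) (length-filter-concatMap h (f ∘ suc) n) ⟩
      length (filter P? (h (f 0))) + ∑ n (λ i → length (filter P? (h (f (suc i)))))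
                                                               ≡⟨ ∑-suc n (λ i → length (filter P? (h (f i)))) ⟨
      ∑ (suc n) (λ i → length (filter P? (h (f i))))           ∎
      where
      open ≡-Reasoning
      rest : List A
      rest = concatMap h (applyUpTo (f ∘ suc) n)

module Densities where

  open import Data.Nat
  open import Data.Nat.Properties
  open import Data.Nat.DivMod using (m≡m%n+[m/n]*n; m%n<n; m/n*n≤m)
  open import Data.Nat.Tactic.RingSolver using (solve-∀)
  open import Data.Product using (_×_; _,_; ∃-syntax)
  open import Data.Sum using (_⊎_; inj₁; inj₂)
  open import Relation.Binary.PropositionalEquality
  open FiniteSums

  Syndetic : ℕ → (ℕ → Set) → Set
  Syndetic S P = ∀ t → ∃[ n ] (t ≤ n × n < t + S × P n)

  syndetic-map : ∀ {S} {P Q : ℕ → Set} → (∀ {n} → P n → Q n) → Syndetic S P → Syndetic S Q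
  syndetic-map P⇒Q syn t with syn t
  ... | n , t≤n , n<t+S , Pn = n , t≤n , n<t+S , P⇒Q Pn

  syndetic-orbit : ∀ {a} {P : ℕ → Set} → 1 ≤ a → P 0 → (∀ n → P n → P (a + n)) → Syndetic a P
  syndetic-orbit 1≤a P0 step zero = 0 , z≤n , 1≤a , P0
  syndetic-orbit {a} 1≤a P0 step (suc t) with syndetic-orbit 1≤a P0 step t
  ... | n , t≤n , n<t+a , Pn with m≤n⇒m<n∨m≡n t≤n
  ...   | inj₁ t<n  = n , t<n , m<n⇒m<1+n n<t+a , Pn
  ...   | inj₂ refl = a + n , +-monoˡ-≤ n 1≤a , s≤s (≤-reflexive (+-comm a n)) , step n Pn

  syndetic-step : ∀ {a S} {P Q : ℕ → Set} → (∀ n → Q (a + n) → P (a + n) ⊎ P n) → Syndetic S Q → Syndetic (a + S) P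
  syndetic-step {a} {S} {P} {Q} split syn t with syn (t + a)
  ... | n′ , t+a≤n′ , n′<t+a+S , Qn′ = pick (split n (subst Q (sym a+n≡n′) Qn′))
    where
    n : ℕ
    n = n′ ∸ a
    a+n≡n′ : a + n ≡ n′
    a+n≡n′ = m+[n∸m]≡n (m+n≤o⇒n≤o t t+a≤n′)
    t≤n : t ≤ n
    t≤n = m+n≤o⇒m≤o∸n t t+a≤n′
    n′<bound : n′ < t + (a + S)
    n′<bound = subst (n′ <_) (+-assoc t a S) n′<t+a+S
    pick : P (a + n) ⊎ P n → ∃[ x ] (t ≤ x × x < t + (a + S) × P x)
    pick (inj₁ Pa+n) = a + n , ≤-trans t≤n (m≤n+m n a) , subst (_< t + (a + S)) (sym a+n≡n′) n′<bound , Pa+n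
    pick (inj₂ Pn)   = n , t≤n , ≤-<-trans (m∸n≤m n′ a) n′<bound , Pn

  ∑-syndetic-* : ∀ {S} (f : ℕ → ℕ) → Syndetic S (λ n → 0 < f n) → ∀ j → j ≤ ∑ (j * S) f
  ∑-syndetic-* f syn zero    = z≤n
  ∑-syndetic-* {S} f syn (suc j) with syn (j * S)
  ... | n , jS≤n , n<jS+S , 0<fn = begin
    suc j                    ≡⟨ +-comm 1 j ⟩
    j + 1                    ≤⟨ +-mono-≤ (∑-syndetic-* f syn j) 0<fn ⟩
    ∑ (j * S) f + f n        ≤⟨ ∑-+-term f jS≤n n<jS+S ⟩
    ∑ (j * S + S) f          ≡⟨ cong (λ l → ∑ l f) (+-comm (j * S) S) ⟩
    ∑ (suc j * S) f          ∎
    where open ≤-Reasoning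

  ∑-syndetic : ∀ {S} (f : ℕ → ℕ) → Syndetic S (λ n → 0 < f n) → ∀ N → N < suc (∑ N f) * S
  ∑-syndetic {S} f syn N = begin-strict
    N                        ≡⟨ m≡m%n+[m/n]*n N S ⟩
    N % S + N / S * S        <⟨ +-monoˡ-< (N / S * S) (m%n<n N S) ⟩
    suc (N / S) * S          ≤⟨ *-monoˡ-≤ S (s≤s (≤-trans (∑-syndetic-* f syn (N / S)) (∑-mono-≤ f (m/n*n≤m N S)))) ⟩
    suc (∑ N f) * S          ∎
    where
    open ≤-Reasoning
    instance
      S≢0 : NonZero S
      S≢0 with syn 0
      ... | _ , _ , n<S , _ = >-nonZero (≤-<-trans z≤n n<S)

  ∑-periodic-rate : ∀ {T} (f : ℕ → ℕ) → (∀ i → f i ≤ 1) → Periodic T f → .{{_ : NonZero T}} →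
                    ∀ N → ∣ ∑ N f * T - ∑ T f * N ∣ ≤ T * T
  ∑-periodic-rate {T} f f≤1 per N = begin
    ∣ ∑ N f * T - C * N ∣                               ≡⟨ cong₂ ∣_-_∣ sum-split (cong (C *_) N-split) ⟩
    ∣ (j * C + ∑ r f) * T - C * (j * T + r) ∣           ≡⟨ cong₂ ∣_-_∣ (expand₁ j C (∑ r f) T) (expand₂ j C r T) ⟩
    ∣ j * C * T + ∑ r f * T - (j * C * T + C * r) ∣     ≡⟨ ∣m+n-m+o∣≡∣n-o∣ (j * C * T) (∑ r f * T) (C * r) ⟩
    ∣ ∑ r f * T - C * r ∣                               ≤⟨ ∣m-n∣≤m⊔n (∑ r f * T) (C * r) ⟩
    ∑ r f * T ⊔ C * r                                   ≤⟨ ⊔-lub (*-mono-≤ (≤-trans (∑-≤ r f≤1) r≤T) ≤-refl)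
                                                                 (*-mono-≤ (∑-≤ T f≤1) r≤T) ⟩
    T * T                                               ∎
    where
    open ≤-Reasoning
    C j r : ℕ
    C = ∑ T f
    j = N / T
    r = N % T
    r≤T : r ≤ T
    r≤T = <⇒≤ (m%n<n N T)
    N-split : N ≡ j * T + r
    N-split = trans (m≡m%n+[m/n]*n N T) (+-comm r (j * T))
    sum-split : ∑ N f * T ≡ (j * C + ∑ r f) * T
    sum-split = cong (_* T) (trans (cong (λ l → ∑ l f) N-split) (trans (∑-+ (j * T) r f)
                  (cong₂ _+_ (∑-periodic per j) (∑-cong r (periodic-* per j)))))
    expand₁ : ∀ j C s T → (j * C + s) * T ≡ j * C * T + s * T
    expand₁ = solve-∀
    expand₂ : ∀ j C r T → C * (j * T + r) ≡ j * C * T + C * r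
    expand₂ = solve-∀

  cross-difference : ∀ {T C B x y D D′} → 1 ≤ T → ∣ x * T - C * D ∣ ≤ B → ∣ y * T - C * D′ ∣ ≤ B →
                     ∣ x * D′ - y * D ∣ ≤ B * (D + D′)
  cross-difference {T} {C} {B} {x} {y} {D} {D′} 1≤T hx hy = begin
    ∣ x * D′ - y * D ∣                                       ≤⟨ m≤m*n ∣ x * D′ - y * D ∣ T ⟩
    ∣ x * D′ - y * D ∣ * T                                   ≡⟨ *-distribʳ-∣-∣ T (x * D′) (y * D) ⟩
    ∣ x * D′ * T - y * D * T ∣                               ≤⟨ ∣-∣-triangle (x * D′ * T) (C * D * D′) (y * D * T) ⟩
    ∣ x * D′ * T - C * D * D′ ∣ + ∣ C * D * D′ - y * D * T ∣  ≡⟨ cong₂ _+_ (cong ∣_- C * D * D′ ∣ (swap x D′ T))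
                                                                        (cong₂ ∣_-_∣ (swap C D D′) (swap y D T)) ⟩
    ∣ x * T * D′ - C * D * D′ ∣ + ∣ C * D′ * D - y * T * D ∣  ≡⟨ cong₂ _+_ (*-distribʳ-∣-∣ D′ (x * T) (C * D))
                                                                        (*-distribʳ-∣-∣ D (C * D′) (y * T)) ⟨
    ∣ x * T - C * D ∣ * D′ + ∣ C * D′ - y * T ∣ * D           ≤⟨ +-mono-≤ (*-monoˡ-≤ D′ hx)
                                                                        (*-monoˡ-≤ D (subst (_≤ B) (∣-∣-comm (y * T) (C * D′)) hy)) ⟩
    B * D′ + B * D                                           ≡⟨ +-comm (B * D′) (B * D) ⟩
    B * D + B * D′                                           ≡⟨ *-distribˡ-+ B D D′ ⟨
    B * (D + D′)                                             ∎
    where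
    open ≤-Reasoning
    instance
      T≢0 : NonZero T
      T≢0 = >-nonZero 1≤T
    swap : ∀ a b c → a * b * c ≡ a * c * b
    swap = solve-∀

  *-+-<-* : ∀ {K D D′} → 2 * K < D → 2 * K < D′ → K * (D + D′) < D * D′
  *-+-<-* {K} {D} {D′} 2K<D 2K<D′ = *-cancelˡ-< 2 (K * (D + D′)) (D * D′) (begin-strict
    2 * (K * (D + D′))         ≡⟨ expand K D D′ ⟩
    2 * K * D + 2 * K * D′     <⟨ +-mono-<-≤ (*-monoˡ-< D 2K<D′) (*-monoˡ-≤ D′ (<⇒≤ 2K<D)) ⟩
    D′ * D + D * D′            ≡⟨ double D D′ ⟩
    2 * (D * D′)               ∎)
    where
    open ≤-Reasoning
    instance
      D≢0 : NonZero D
      D≢0 = >-nonZero (≤-<-trans z≤n 2K<D)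
    expand : ∀ K D D′ → 2 * (K * (D + D′)) ≡ 2 * K * D + 2 * K * D′
    expand = solve-∀
    double : ∀ D D′ → D′ * D + D * D′ ≡ 2 * (D * D′)
    double = solve-∀

module Representations where

  open import Defs using (wsum; allVecs; pA; sumA; count)
  open import Data.Nat
  open import Data.Nat.Properties
  open import Data.List using (filter; length; map)
  open import Data.List.Properties using (filter-≐; filter-none)
  open import Data.List.Relation.Unary.All using (universal)
  open import Data.Vec using (_∷_)
  open import Data.Nat.Divisibility using (_∣_; _∤_; _∣?_; >⇒∤; ∣m+n∣m⇒∣n; m%n≡0⇒n∣m; n∣m⇒m%n≡0)
  open import Data.Product using (_,_; _×_; ∃-syntax)
  open import Data.Sum using (_⊎_; inj₁; inj₂)
  open import Relation.Nullary using (Dec; yes; no; ¬?)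
  open import Relation.Binary.PropositionalEquality
  open import Function using (_∘_)
  open FiniteSums
  open Densities

  -- The guard discards the summands in which n ∸ a 0 * x would truncate.
  reps : (ℕ → ℕ) → ℕ → ℕ → ℕ
  reps a zero    zero    = 1
  reps a zero    (suc n) = 0
  reps a (suc k) n       = ∑ (suc n) (λ x → guard (a 0 * x ≤? n) (reps (a ∘ suc) k (n ∸ a 0 * x)))

  summand-vanishes : ∀ {a₀ n x} (v : ℕ) → 1 ≤ a₀ → n < x → guard (a₀ * x ≤? n) v ≡ 0
  summand-vanishes {a₀} {n} {x} v 1≤a₀ n<x =
    guard-reject (λ a₀x≤n → <⇒≱ n<x (≤-trans x≤a₀x a₀x≤n)) (a₀ * x ≤? n)
    where
    x≤a₀x : x ≤ a₀ * x
    x≤a₀x = subst (_≤ a₀ * x) (*-identityˡ x) (*-monoˡ-≤ x 1≤a₀)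

  count-allVecs≡reps : ∀ {a} → (∀ i → 1 ≤ a i) → ∀ k {b c} → c ≤ b →
                       length (filter (λ v → wsum a v ≟ c) (allVecs b k)) ≡ reps a k c
  count-allVecs≡reps pos zero {c = zero}  _ = refl
  count-allVecs≡reps pos zero {c = suc c} _ = refl
  count-allVecs≡reps {a} pos (suc k) {b} {c} c≤b = begin
    length (filter (λ v → wsum a v ≟ c) (allVecs b (suc k)))
      ≡⟨ length-filter-concatMap (λ v → wsum a v ≟ c) (λ x → map (x ∷_) (allVecs b k)) (λ x → x) (suc b) ⟩
    ∑ (suc b) (λ x → length (filter (λ v → wsum a v ≟ c) (map (x ∷_) (allVecs b k))))
      ≡⟨ ∑-cong (suc b) first-coordinate ⟩
    ∑ (suc b) term
      ≡⟨ ∑-truncate term (s≤s c≤b) (λ x c<x → summand-vanishes _ (pos 0) c<x) ⟩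
    reps a (suc k) c ∎
    where
    open ≡-Reasoning
    term : ℕ → ℕ
    term x = guard (a 0 * x ≤? c) (reps (a ∘ suc) k (c ∸ a 0 * x))
    first-coordinate : ∀ x → length (filter (λ v → wsum a v ≟ c) (map (x ∷_) (allVecs b k))) ≡ term x
    first-coordinate x = trans (length-filter-map (λ v → wsum a v ≟ c) (x ∷_) (allVecs b k)) (split (a 0 * x ≤? c))
      where
      split : (d : Dec (a 0 * x ≤ c)) →
              length (filter (λ v → a 0 * x + wsum (a ∘ suc) v ≟ c) (allVecs b k)) ≡ guard d (reps (a ∘ suc) k (c ∸ a 0 * x))
      split (yes a₀x≤c) = trans
        (cong length (filter-≐ _ _ ((λ e → trans (sym (m+n∸m≡n (a 0 * x) _)) (cong (_∸ a 0 * x) e))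
                                  , (λ e → trans (cong (a 0 * x +_) e) (m+[n∸m]≡n a₀x≤c))) (allVecs b k)))
        (count-allVecs≡reps (pos ∘ suc) k (≤-trans (m∸n≤m c (a 0 * x)) c≤b))
      split (no a₀x≰c) =
        cong length (filter-none _ (universal (λ v e → a₀x≰c (subst (a 0 * x ≤_) e (m≤m+n _ _))) (allVecs b k)))

  pA≡reps : ∀ {a} → (∀ i → 1 ≤ a i) → ∀ n k → pA a n k ≡ reps a k n
  pA≡reps pos n k = count-allVecs≡reps pos k ≤-refl

  reps[0]≡1 : ∀ a k → reps a k 0 ≡ 1
  reps[0]≡1 a zero    = refl
  reps[0]≡1 a (suc k) =
    trans (guard-accept (≤-reflexive (*-zeroʳ (a 0))) (a 0 * 0 ≤? 0))
          (trans (cong (λ z → reps (a ∘ suc) k (0 ∸ z)) (*-zeroʳ (a 0))) (reps[0]≡1 (a ∘ suc) k))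

  reps-recurrence : ∀ a → 1 ≤ a 0 → ∀ k n →
                    reps a (suc k) (a 0 + n) ≡ reps (a ∘ suc) k (a 0 + n) + reps a (suc k) n
  reps-recurrence a 1≤a₀ k n = begin
    ∑ (suc (a₀ + n)) term′                      ≡⟨ ∑-suc (a₀ + n) term′ ⟩
    term′ 0 + ∑ (a₀ + n) (term′ ∘ suc)          ≡⟨ cong₂ _+_ first (∑-cong (a₀ + n) shift) ⟩
    reps′ (a₀ + n) + ∑ (a₀ + n) term            ≡⟨ cong (reps′ (a₀ + n) +_) (∑-truncate term n<a₀+n
                                                                               (λ x n<x → summand-vanishes _ 1≤a₀ n<x)) ⟩
    reps′ (a₀ + n) + ∑ (suc n) term             ∎
    where
    open ≡-Reasoning
    a₀ : ℕ
    a₀ = a 0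
    reps′ : ℕ → ℕ
    reps′ = reps (a ∘ suc) k
    term term′ : ℕ → ℕ
    term  x = guard (a₀ * x ≤? n) (reps′ (n ∸ a₀ * x))
    term′ x = guard (a₀ * x ≤? a₀ + n) (reps′ (a₀ + n ∸ a₀ * x))
    n<a₀+n : suc n ≤ a₀ + n
    n<a₀+n = +-monoˡ-≤ n 1≤a₀
    first : term′ 0 ≡ reps′ (a₀ + n)
    first = trans (guard-accept (subst (_≤ a₀ + n) (sym (*-zeroʳ a₀)) z≤n) (a₀ * 0 ≤? a₀ + n))
                  (cong (λ z → reps′ (a₀ + n ∸ z)) (*-zeroʳ a₀))
    shift : ∀ x → term′ (suc x) ≡ term x
    shift x rewrite *-suc a₀ x =
      guard-cong (+-cancelˡ-≤ a₀ _ _) (+-monoʳ-≤ a₀) (a₀ + a₀ * x ≤? a₀ + n) (a₀ * x ≤? n)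
                 (cong reps′ ([m+n]∸[m+o]≡n∸o a₀ n (a₀ * x)))

  reps₁-periodic : ∀ a → 1 ≤ a 0 → Periodic (a 0) (reps a 1)
  reps₁-periodic a 1≤a₀ n =
    trans (reps-recurrence a 1≤a₀ 0 n) (cong (_+ reps a 1 n) (nonzero (a 0 + n) (≤-trans 1≤a₀ (m≤m+n (a 0) n))))
    where
    nonzero : ∀ m → 1 ≤ m → reps (a ∘ suc) 0 m ≡ 0
    nonzero (suc m) _ = refl

  reps-periodic-% : ∀ {a} → (∀ i → 1 ≤ a i) → ∀ m .{{_ : NonZero m}} k →
                    ∃[ T ] (1 ≤ T × Periodic T (λ n → reps a (suc k) n % m))
  reps-periodic-% {a} pos m zero    = a 0 , pos 0 , λ n → cong (_% m) (reps₁-periodic a (pos 0) n)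
  reps-periodic-% {a} pos m (suc k) with reps-periodic-% (pos ∘ suc) m k
  ... | T , 1≤T , per = a 0 * (m * T) , *-mono-≤ (pos 0) (*-mono-≤ (>-nonZero⁻¹ m) 1≤T)
                      , recurrence-periodic-% m (reps-recurrence a (pos 0) (suc k)) per

  sumA-suc : ∀ a k → sumA a (suc k) ≡ a 0 + sumA (a ∘ suc) k
  sumA-suc a zero    = +-comm 0 (a 0)
  sumA-suc a (suc k) = trans (cong (_+ a (suc k)) (sumA-suc a k)) (+-assoc (a 0) (sumA (a ∘ suc) k) (a (suc k)))

  reps-syndetic : ∀ {a} → (∀ i → 1 ≤ a i) → ∀ {m} → 1 < m → ∀ k →
                  Syndetic (sumA a (suc k)) (λ n → m ∤ reps a (suc k) n)
  reps-syndetic {a} pos {m} 1<m zero =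
    syndetic-orbit (pos 0) (λ m∣ → >⇒∤ 1<m (subst (m ∣_) (reps[0]≡1 a 1) m∣))
                   (λ n m∤ m∣ → m∤ (subst (m ∣_) (reps₁-periodic a (pos 0) n) m∣))
  reps-syndetic {a} pos {m} 1<m (suc k) =
    subst (λ S → Syndetic S (λ n → m ∤ reps a (suc (suc k)) n)) (sym (sumA-suc a (suc k)))
          (syndetic-step split (reps-syndetic (pos ∘ suc) 1<m k))
    where
    split : ∀ n → m ∤ reps (a ∘ suc) (suc k) (a 0 + n) →
            m ∤ reps a (suc (suc k)) (a 0 + n) ⊎ m ∤ reps a (suc (suc k)) n
    split n m∤head with m ∣? reps a (suc (suc k)) n
    ... | no  m∤tail = inj₂ m∤tail
    ... | yes m∣tail = inj₁ λ m∣all → m∤head (∣m+n∣m⇒∣n (subst (m ∣_) swapped m∣all) m∣tail)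
      where
      swapped : reps a (suc (suc k)) (a 0 + n) ≡ reps a (suc (suc k)) n + reps (a ∘ suc) (suc k) (a 0 + n)
      swapped = trans (reps-recurrence a (pos 0) (suc k) n) (+-comm (reps (a ∘ suc) (suc k) (a 0 + n)) _)

  module _ {a : ℕ → ℕ} (pos : ∀ i → 1 ≤ a i) {m : ℕ} (1<m : 1 < m) (k : ℕ) where

    private
      instance
        m≢0 : NonZero m
        m≢0 = >-nonZero (<-trans z<s 1<m)

      χ : ℕ → ℕ
      χ n = guard (¬? (m ∣? pA a n (suc k))) 1

      count≡∑χ : ∀ N → count a m (suc k) N ≡ ∑ (suc N) χ
      count≡∑χ N = length-filter-applyUpTo (λ n → ¬? (m ∣? pA a n (suc k))) (λ n → n) (suc N)

      χ≤1 : ∀ n → χ n ≤ 1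
      χ≤1 n = guard-≤ (¬? (m ∣? pA a n (suc k)))

      ∣-respects-% : ∀ {x y} → x % m ≡ y % m → m ∣ x → m ∣ y
      ∣-respects-% {x} {y} x≡y m∣x = m%n≡0⇒n∣m y m (trans (sym x≡y) (n∣m⇒m%n≡0 x m m∣x))

    count-linear : ∃[ T ] ∃[ C ] (1 ≤ T × ∀ N → ∣ count a m (suc k) N * T - C * N ∣ ≤ T * T + T)
    count-linear with reps-periodic-% pos m k
    ... | T , 1≤T , per = T , ∑ T χ , 1≤T , bound
      where
      instance
        T≢0 : NonZero T
        T≢0 = >-nonZero 1≤T
      χ-periodic : Periodic T χ
      χ-periodic n = guard-cong (λ m∤ m∣ → m∤ (∣-respects-% (sym pA≡%pA) m∣)) (λ m∤ m∣ → m∤ (∣-respects-% pA≡%pA m∣))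
                                (¬? (m ∣? pA a (T + n) (suc k))) (¬? (m ∣? pA a n (suc k))) refl
        where
        pA≡%pA : pA a (T + n) (suc k) % m ≡ pA a n (suc k) % m
        pA≡%pA = trans (cong (_% m) (pA≡reps pos (T + n) (suc k))) (trans (per n) (cong (_% m) (sym (pA≡reps pos n (suc k)))))
      bound : ∀ N → ∣ count a m (suc k) N * T - ∑ T χ * N ∣ ≤ T * T + T
      bound N = begin
        ∣ count a m (suc k) N * T - C * N ∣                 ≡⟨ cong (λ c → ∣ c * T - C * N ∣) (count≡∑χ N) ⟩
        ∣ ∑ (suc N) χ * T - C * N ∣                         ≤⟨ ∣-∣-triangle (∑ (suc N) χ * T) (C * suc N) (C * N) ⟩
        ∣ ∑ (suc N) χ * T - C * suc N ∣ + ∣ C * suc N - C * N ∣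
                                                            ≤⟨ +-mono-≤ (∑-periodic-rate χ χ≤1 χ-periodic (suc N)) last-step ⟩
        T * T + T                                           ∎
        where
        open ≤-Reasoning
        C : ℕ
        C = ∑ T χ
        last-step : ∣ C * suc N - C * N ∣ ≤ T
        last-step = begin
          ∣ C * suc N - C * N ∣       ≡⟨ cong ∣_- C * N ∣ (*-suc C N) ⟩
          ∣ C + C * N - C * N ∣       ≡⟨ ∣-∣-comm (C + C * N) (C * N) ⟩
          ∣ C * N - C + C * N ∣       ≡⟨ cong ∣ C * N -_∣ (+-comm C (C * N)) ⟩
          ∣ C * N - C * N + C ∣       ≡⟨ ∣m-m+n∣≡n (C * N) C ⟩
          C                           ≤⟨ ∑-≤ T χ≤1 ⟩
          T                           ∎

    count-lower-bound : ∀ N → N < suc (count a m (suc k) N) * sumA a (suc k)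
    count-lower-bound N = begin-strict
      N                                        <⟨ n<1+n N ⟩
      suc N                                    <⟨ ∑-syndetic χ χ-syndetic (suc N) ⟩
      suc (∑ (suc N) χ) * sumA a (suc k)       ≡⟨ cong (λ c → suc c * sumA a (suc k)) (count≡∑χ N) ⟨
      suc (count a m (suc k) N) * sumA a (suc k) ∎
      where
      open ≤-Reasoning
      χ-syndetic : Syndetic (sumA a (suc k)) (λ n → 0 < χ n)
      χ-syndetic = syndetic-map counted (reps-syndetic pos 1<m k)
        where
        counted : ∀ {n} → m ∤ reps a (suc k) n → 0 < χ n
        counted {n} m∤ = ≤-reflexive (sym (guard-accept (m∤ ∘ subst (m ∣_) (pA≡reps pos n (suc k))) (¬? (m ∣? pA a n (suc k)))))

open import Defs using (ratio; sumA; count)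
open import Data.Nat as ℕ using (ℕ; zero; suc; s≤s; _≤_; _>_; _≥_)
import Data.Nat.Properties as ℕ
open import Data.Nat.Coprimality using (Coprime)
open import Data.Nat.Tactic.RingSolver using (solve-∀)
open import Data.Integer as ℤ using (+_; +[1+_]; -[1+_]; +<+)
import Data.Integer.Properties as ℤ
open import Data.Product using (_×_; _,_; ∃-syntax)
open import Data.Rational using (ℚ; mkℚ; 0ℚ; 1ℚ; _/_; _+_; _-_; -_; _*_; ∣_∣; _<_; *<*; toℚᵘ)
import Data.Rational.Properties as ℚ
import Data.Rational.Unnormalised as ℚᵘ
import Data.Rational.Unnormalised.Properties as ℚᵘ
open import Data.Sum using (inj₁; inj₂)
open import Relation.Binary.PropositionalEquality
open Densities using (cross-difference; *-+-<-*)
open Representations using (count-linear; count-lower-bound)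

Cauchy : (ℕ → ℚ) → Set
Cauchy x = (ε : ℚ) → 0ℚ < ε → ∃[ M₀ ] (∀ M M′ → M₀ ≤ M → M₀ ≤ M′ → ∣ x M - x M′ ∣ < ε)

∣+-+∣≡∣-∣ : ∀ m n → ℤ.∣ + m ℤ.- + n ∣ ≡ ℕ.∣ m - n ∣
∣+-+∣≡∣-∣ m n with ℕ.≤-total m n
... | inj₁ m≤n = trans (cong ℤ.∣_∣ (ℤ.m-n≡m⊖n m n)) (trans (ℤ.∣⊖∣-≤ m≤n) (sym (ℕ.m≤n⇒∣m-n∣≡n∸m m≤n)))
... | inj₂ n≤m = trans (cong ℤ.∣_∣ (ℤ.m-n≡m⊖n m n))
  (trans (ℤ.∣m⊖n∣≡∣n⊖m∣ m n) (trans (ℤ.∣⊖∣-≤ n≤m) (sym (ℕ.m≤n⇒∣n-m∣≡n∸m n≤m))))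

-- Comparisons in ℚ are moved to the unnormalised images, where < is integer cross-multiplication.
∣/-/∣< : ∀ x M y M′ p δ .(c : Coprime (suc p) (suc δ)) →
         ℕ.∣ x ℕ.* suc M′ - y ℕ.* suc M ∣ ℕ.* suc δ ℕ.< suc p ℕ.* (suc M ℕ.* suc M′) →
         ∣ + x / suc M - + y / suc M′ ∣ < mkℚ +[1+ p ] δ c
∣/-/∣< x M y M′ p δ c h = ℚ.toℚᵘ-cancel-< (ℚᵘ.<-respˡ-≃ (ℚᵘ.≃-sym image) (ℚᵘ.*<* cross))
  where
  X Y : ℚ
  X = + x / suc M
  Y = + y / suc M′
  image : toℚᵘ ∣ X - Y ∣ ℚᵘ.≃ ℚᵘ.∣ ℚᵘ.mkℚᵘ (+ x) M ℚᵘ.- ℚᵘ.mkℚᵘ (+ y) M′ ∣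
  image = ℚᵘ.≃-trans (ℚ.toℚᵘ-homo-∣-∣ (X - Y)) (ℚᵘ.∣-∣-cong (ℚᵘ.≃-trans (ℚ.toℚᵘ-homo-+ X (- Y))
    (ℚᵘ.+-cong (ℚ.toℚᵘ-fromℚᵘ (ℚᵘ.mkℚᵘ (+ x) M))
               (ℚᵘ.≃-trans (ℚ.toℚᵘ-homo‿- Y) (ℚᵘ.-‿cong (ℚ.toℚᵘ-fromℚᵘ (ℚᵘ.mkℚᵘ (+ y) M′)))))))
  numerator : + x ℤ.* + suc M′ ℤ.+ ℤ.- (+ y) ℤ.* + suc M ≡ + (x ℕ.* suc M′) ℤ.- + (y ℕ.* suc M)
  numerator = cong₂ ℤ._+_ (sym (ℤ.pos-* x (suc M′)))
                          (trans (sym (ℤ.neg-distribˡ-* (+ y) (+ suc M))) (cong ℤ.-_ (sym (ℤ.pos-* y (suc M)))))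
  cross : + ℤ.∣ + x ℤ.* + suc M′ ℤ.+ ℤ.- (+ y) ℤ.* + suc M ∣ ℤ.* + suc δ ℤ.< +[1+ p ] ℤ.* + (suc M ℕ.* suc M′)
  cross = subst₂ ℤ._<_
    (trans (ℤ.pos-* d (suc δ)) (cong (λ z → + z ℤ.* + suc δ)
      (sym (trans (cong ℤ.∣_∣ numerator) (∣+-+∣≡∣-∣ (x ℕ.* suc M′) (y ℕ.* suc M))))))
    (ℤ.pos-* (suc p) (suc M ℕ.* suc M′)) (+<+ h)
    where
    d : ℕ
    d = ℕ.∣ x ℕ.* suc M′ - y ℕ.* suc M ∣

1<[/+]* : ∀ x M S p δ .(c : Coprime (suc p) (suc δ)) →
          suc M ℕ.* suc δ ℕ.< (x ℕ.* suc δ ℕ.+ suc p ℕ.* suc M) ℕ.* S →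
          1ℚ < (+ x / suc M + mkℚ +[1+ p ] δ c) * (+ S / 1)
1<[/+]* x M S p δ c h = ℚ.toℚᵘ-cancel-< (ℚᵘ.<-respʳ-≃ (ℚᵘ.≃-sym image) (ℚᵘ.*<* cross))
  where
  X ε : ℚ
  X = + x / suc M
  ε = mkℚ +[1+ p ] δ c
  image : toℚᵘ ((X + ε) * (+ S / 1)) ℚᵘ.≃ (ℚᵘ.mkℚᵘ (+ x) M ℚᵘ.+ ℚᵘ.mkℚᵘ +[1+ p ] δ) ℚᵘ.* ℚᵘ.mkℚᵘ (+ S) 0
  image = ℚᵘ.≃-trans (ℚ.toℚᵘ-homo-* (X + ε) (+ S / 1))
    (ℚᵘ.*-cong (ℚᵘ.≃-trans (ℚ.toℚᵘ-homo-+ X ε) (ℚᵘ.+-cong (ℚ.toℚᵘ-fromℚᵘ (ℚᵘ.mkℚᵘ (+ x) M)) ℚᵘ.≃-refl))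
               (ℚ.toℚᵘ-fromℚᵘ (ℚᵘ.mkℚᵘ (+ S) 0)))
  n : ℕ
  n = x ℕ.* suc δ ℕ.+ suc p ℕ.* suc M
  cross : + 1 ℤ.* + (suc M ℕ.* suc δ ℕ.* 1) ℤ.< (+ x ℤ.* + suc δ ℤ.+ +[1+ p ] ℤ.* + suc M) ℤ.* + S ℤ.* + 1
  cross = subst₂ ℤ._<_
    (trans (cong +_ (sym (ℕ.*-identityʳ (suc M ℕ.* suc δ)))) (sym (ℤ.*-identityˡ (+ (suc M ℕ.* suc δ ℕ.* 1)))))
    (trans (ℤ.pos-* (n ℕ.* S) 1) (cong (ℤ._* + 1) (trans (ℤ.pos-* n S) (cong (ℤ._* + S)
      (trans (ℤ.pos-+ (x ℕ.* suc δ) (suc p ℕ.* suc M)) (cong₂ ℤ._+_ (ℤ.pos-* x (suc δ)) (ℤ.pos-* (suc p) (suc M))))))))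
    (+<+ (ℕ.<-≤-trans h (ℕ.≤-reflexive (sym (ℕ.*-identityʳ (n ℕ.* S))))))

ratio-cauchy : ∀ (u : ℕ → ℕ) {T C B} → 1 ≤ T → (∀ M → ℕ.∣ u M ℕ.* T - C ℕ.* suc M ∣ ≤ B) →
               Cauchy (λ M → + u M / suc M)
ratio-cauchy u 1≤T rate (mkℚ (+ 0)     _ _) (*<* (+<+ ()))
ratio-cauchy u 1≤T rate (mkℚ -[1+ _ ] _ _) (*<* ())
ratio-cauchy u {T} {C} {B} 1≤T rate (mkℚ +[1+ p ] δ c) _ = 2 ℕ.* K , close
  where
  -- ∣ x M - x M′ ∣ ≤ B (D + D′) / (D D′) < 1 / (δ + 1) ≤ ε as soon as D, D′ > 2 B (δ + 1).
  K : ℕ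
  K = B ℕ.* suc δ
  close : ∀ M M′ → 2 ℕ.* K ≤ M → 2 ℕ.* K ≤ M′ → ∣ + u M / suc M - + u M′ / suc M′ ∣ < mkℚ +[1+ p ] δ c
  close M M′ 2K≤M 2K≤M′ = ∣/-/∣< (u M) M (u M′) M′ p δ c (begin-strict
    ℕ.∣ u M ℕ.* suc M′ - u M′ ℕ.* suc M ∣ ℕ.* suc δ   ≤⟨ ℕ.*-monoˡ-≤ (suc δ) (cross-difference {C = C} {x = u M} {u M′}
                                                                                 {suc M} {suc M′} 1≤T (rate M) (rate M′)) ⟩
    B ℕ.* (suc M ℕ.+ suc M′) ℕ.* suc δ               ≡⟨ reorder B (suc M ℕ.+ suc M′) (suc δ) ⟩
    K ℕ.* (suc M ℕ.+ suc M′)                         <⟨ *-+-<-* {K} (s≤s 2K≤M) (s≤s 2K≤M′) ⟩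
    suc M ℕ.* suc M′                                 ≤⟨ ℕ.m≤n*m (suc M ℕ.* suc M′) (suc p) ⟩
    suc p ℕ.* (suc M ℕ.* suc M′)                     ∎)
    where
    open ℕ.≤-Reasoning
    reorder : ∀ B D e → B ℕ.* D ℕ.* e ≡ B ℕ.* e ℕ.* D
    reorder = solve-∀

ratio-eventually-above : ∀ (u : ℕ → ℕ) S → (∀ M → suc M ℕ.< suc (u M) ℕ.* S) →
                         (ε : ℚ) → 0ℚ < ε → ∃[ M₀ ] (∀ M → M₀ ≤ M → 1ℚ < (+ u M / suc M + ε) * (+ S / 1))
ratio-eventually-above u S dense (mkℚ (+ 0)     _ _) (*<* (+<+ ()))
ratio-eventually-above u S dense (mkℚ -[1+ _ ] _ _) (*<* ())
ratio-eventually-above u S dense (mkℚ +[1+ p ] δ c) _ = δ , above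
  where
  -- ε (M + 1) ≥ 1 once M ≥ δ, which absorbs the + 1 in suc (u M).
  above : ∀ M → δ ≤ M → 1ℚ < (+ u M / suc M + mkℚ +[1+ p ] δ c) * (+ S / 1)
  above M δ≤M = 1<[/+]* (u M) M S p δ c (begin-strict
    suc M ℕ.* suc δ                                 <⟨ ℕ.*-monoˡ-< (suc δ) (dense M) ⟩
    suc (u M) ℕ.* S ℕ.* suc δ                       ≡⟨ reorder (u M) S (suc δ) ⟩
    (u M ℕ.* suc δ ℕ.+ suc δ) ℕ.* S                 ≤⟨ ℕ.*-monoˡ-≤ S (ℕ.+-monoʳ-≤ (u M ℕ.* suc δ)
                                                          (ℕ.≤-trans (s≤s δ≤M) (ℕ.m≤n*m (suc M) (suc p)))) ⟩
    (u M ℕ.* suc δ ℕ.+ suc p ℕ.* suc M) ℕ.* S       ∎)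
    where
    open ℕ.≤-Reasoning
    reorder : ∀ u S e → suc u ℕ.* S ℕ.* e ≡ (u ℕ.* e ℕ.+ e) ℕ.* S
    reorder = solve-∀

theorem5p2 : (a : ℕ → ℕ) → (∀ i → 1 ≤ a i) → (m : ℕ) → m > 1 → (k : ℕ) → k ≥ 1 →
    ((ε : ℚ) → 0ℚ < ε → ∃[ M₀ ] (∀ M M′ → M₀ ≤ M → M₀ ≤ M′ →
        ∣ ratio a m k M - ratio a m k M′ ∣ < ε))
    × ((ε : ℚ) → 0ℚ < ε → ∃[ M₀ ] (∀ M → M₀ ≤ M →
        1ℚ < (ratio a m k M + ε) * (+ sumA a k / 1)))
theorem5p2 a pos m 1<m zero ()
theorem5p2 a pos m 1<m (suc k) _ =
  let T , C , 1≤T , linear = count-linear pos 1<m k in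
    ratio-cauchy u {C = C} 1≤T (λ M → linear (suc M))
  , ratio-eventually-above u (sumA a (suc k)) (λ M → count-lower-bound pos 1<m k (suc M))
  where
  u : ℕ → ℕ
  u M = count a m (suc k) (suc M)
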